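{- Let $r\ge 1$ and let $D,S$ be finite sets of positive integers such that one of them equals $\{1,2,\ldots,r\}$ and the other is a subset of $\{1,2,\ldots,r\}$. Then there exists a finite graph $H$ with a distinguished vertex $v$ and a legal partial colouring of $H$ (some vertices blue, some red, the rest uncoloured, with $v$ uncoloured) with the following property: whenever $H$ is joined to an arbitrary graph $G$ (with an arbitrary legal partial colouring) by adding edges only between $v$ and vertices of $G$, then in the resulting position of $\mathrm{Distance}(D,S)$ every uncoloured vertex of $H$ (in particular $v$) can be coloured by neither player, and every coloured vertex of $H$ is at graph distance at least $r+1$ from every vertex of $G$ (so the coloured vertices of $H$ impose no restriction on play at vertices of $G$).
   Context: For finite sets $D,S$ of positive integers, the distance game $\mathrm{Distance}(D,S)$ is a two-player game (Left and Right) on a finite simple graph whose vertices are blue (Left piece), red (Right piece), or uncoloured. A player moves by placing a piece of their own colour on an uncoloured vertex, subject to: a blue and a red piece may never be at graph distance $d\in D$, and two pieces of the same colour may never be at graph distance $s\in S$. A partial colouring is legal if its coloured vertices satisfy these constraints. An uncoloured vertex $u$ can be coloured blue if no red vertex is at distance in $D$ from $u$ and no blue vertex is at distance in $S$ from $u$; symmetrically for red. -}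

module Defs where

open import Data.Nat using (ℕ; zero; suc; _+_; _≤_; _<_)
open import Data.Fin using (Fin; splitAt; _≟_; _↑ˡ_; _↑ʳ_)
open import Data.Bool using (Bool; true; false; _∧_)
open import Data.Sum using (_⊎_; inj₁; inj₂)
open import Data.Product using (_×_; Σ; ∃; _,_)
open import Data.List using (List)
open import Data.List.Membership.Propositional using (_∈_)
open import Relation.Nullary using (¬_)
open import Relation.Nullary.Decidable using (⌊_⌋)
open import Relation.Binary.PropositionalEquality using (_≡_; _≢_)

record Graph (n : ℕ) : Set where
  field
    adj    : Fin n → Fin n → Bool
    sym    : ∀ u w → adj u w ≡ adj w u
    irrefl : ∀ u → adj u u ≡ false
open Graph public

data Walk {n : ℕ} (A : Fin n → Fin n → Bool) : Fin n → Fin n → ℕ → Set where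
  here : ∀ {u} → Walk A u u zero
  step : ∀ {u w x k} → A u w ≡ true → Walk A w x k → Walk A u x (suc k)

-- Graph distance: d is the length of a shortest walk from u to w.
-- (If u and w are in different components, there is no such d.)
Dist : {n : ℕ} → (Fin n → Fin n → Bool) → Fin n → Fin n → ℕ → Set
Dist A u w d = Walk A u w d × (∀ k → k < d → ¬ Walk A u w k)

data Colour : Set where
  blue red none : Colour

Colouring : ℕ → Set
Colouring n = Fin n → Colour

Legal : (D S : List ℕ) {n : ℕ} → (Fin n → Fin n → Bool) → Colouring n → Set
Legal D S {n} A c =
  (∀ u w d → c u ≡ blue → c w ≡ red → Dist A u w d → ¬ (d ∈ D)) ×
  (∀ u w s → c u ≡ blue → c w ≡ blue → Dist A u w s → ¬ (s ∈ S)) ×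
  (∀ u w s → c u ≡ red  → c w ≡ red  → Dist A u w s → ¬ (s ∈ S))

CanBlue : (D S : List ℕ) {n : ℕ} → (Fin n → Fin n → Bool) → Colouring n → Fin n → Set
CanBlue D S A c u =
  c u ≡ none ×
  (∀ w d → c w ≡ red  → Dist A u w d → ¬ (d ∈ D)) ×
  (∀ w s → c w ≡ blue → Dist A u w s → ¬ (s ∈ S))

CanRed : (D S : List ℕ) {n : ℕ} → (Fin n → Fin n → Bool) → Colouring n → Fin n → Set
CanRed D S A c u =
  c u ≡ none ×
  (∀ w d → c w ≡ blue → Dist A u w d → ¬ (d ∈ D)) ×
  (∀ w s → c w ≡ red  → Dist A u w s → ¬ (s ∈ S))

-- Join H (on Fin m) with distinguished vertex v to G (on Fin n), adding
-- edges exactly between v and the vertices b of G with E b ≡ true.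
-- Vertices of H are u ↑ˡ n, vertices of G are m ↑ʳ b.
joinAdj : {m n : ℕ} → Graph m → Fin m → Graph n → (Fin n → Bool) →
          Fin (m + n) → Fin (m + n) → Bool
joinAdj {m} H v G E x y with splitAt m x | splitAt m y
... | inj₁ a | inj₁ b = adj H a b
... | inj₂ a | inj₂ b = adj G a b
... | inj₁ a | inj₂ b = ⌊ a ≟ v ⌋ ∧ E b
... | inj₂ a | inj₁ b = ⌊ b ≟ v ⌋ ∧ E a

joinCol : {m n : ℕ} → Colouring m → Colouring n → Colouring (m + n)
joinCol {m} cH cG x with splitAt m x
... | inj₁ a = cH a
... | inj₂ b = cG b

IsInterval : ℕ → List ℕ → Set
IsInterval r X = ∀ x → (x ∈ X → 1 ≤ x × x ≤ r) × (1 ≤ x → x ≤ r → x ∈ X)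

SubInterval : ℕ → List ℕ → Set
SubInterval r X = ∀ x → x ∈ X → 1 ≤ x × x ≤ r

-- The gadget is a path from a red vertex to a blue vertex of length r + 1, together with a hub
-- joined to two path vertices placed symmetrically around the middle and a tail of length
-- ⌊(r - 1)/2⌋ from the hub to v. Every uncoloured vertex then lies within distance r of both
-- coloured vertices, so whichever of D and S is {1, …, r} forbids both colours there. The
-- lower bounds (red and blue are more than r apart, and more than r away from anything
-- attached at v) come from two 1-Lipschitz potentials, the distance to either end along the
-- path, continued down the tail so that v gets value 1; extended by 0 to the attached graph
-- they stay 1-Lipschitz, and along a walk a 1-Lipschitz potential drops by at most its length.
module Submission where

open import Defs hiding (sym)
open import Data.Nat using (ℕ; zero; suc; _+_; _∸_; _≤_; _<_; z≤n; s≤s; s≤s⁻¹; _≟_; _≤?_; ⌊_/2⌋; ⌈_/2⌉; ∣_-_∣)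
open import Data.Nat.Properties
  using (≤-refl; ≤-trans; ≤-reflexive; n≤1+n; m≤n⇒m≤1+n; <⇒≤; <⇒≱; 1+n≰n; ≤∧≢⇒<; ≰⇒>; m≤n+m;
         +-monoˡ-≤; +-suc; +-comm; +-identityʳ; m∸n≤m; ∸-monoˡ-≤; +-∸-assoc; m+n∸n≡m; m∸n+n≡m;
         ∣m-m+n∣≡n; ∣-∣-identityʳ; ⌊n/2⌋≤⌈n/2⌉; ⌊n/2⌋+⌈n/2⌉≡n; ⌈n/2⌉≤n; ⌊n/2⌋≤n; anyUpTo?)
open import Data.Nat.Induction using (<-rec)
open import Data.Fin using (Fin; toℕ; fromℕ; fromℕ<; splitAt; _↑ˡ_; _↑ʳ_)
import Data.Fin as Fin
open import Data.Fin.Properties using (any?; toℕ-injective; toℕ-fromℕ; toℕ-fromℕ<; toℕ<n; splitAt-↑ˡ; splitAt-↑ʳ)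
open import Data.Bool using (Bool; true; _∧_)
import Data.Bool as Bool
open import Data.Bool.Properties using (∨-comm)
open import Data.Sum using (_⊎_; inj₁; inj₂; [_,_])
open import Data.Product using (_×_; Σ; ∃; _,_; proj₁; proj₂)
open import Data.List using (List)
open import Data.List.Membership.Propositional using (_∈_)
open import Data.Empty using (⊥-elim)
open import Function using (_∘_; case_of_)
open import Relation.Nullary using (¬_; Dec; yes; no; does; proof; Reflects; invert)
open import Relation.Nullary.Decidable using (⌊_⌋; map′; _×-dec_; _⊎-dec_; dec-true; dec-false)
open import Relation.Binary.PropositionalEquality using (_≡_; _≢_; refl; sym; trans; cong; subst)

private
  variable
    n n′ k : ℕ

WithinOne : ℕ → ℕ → Set
WithinOne a b = a ≤ suc b × b ≤ suc a

∣-∣-suc-withinOne : ∀ x e → WithinOne ∣ x - e ∣ ∣ suc x - e ∣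
∣-∣-suc-withinOne zero    zero    = z≤n , ≤-refl
∣-∣-suc-withinOne zero    (suc e) = ≤-refl , m≤n⇒m≤1+n (n≤1+n e)
∣-∣-suc-withinOne (suc x) zero    = m≤n⇒m≤1+n (n≤1+n (suc x)) , ≤-refl
∣-∣-suc-withinOne (suc x) (suc e) = ∣-∣-suc-withinOne x e

⌈n/2⌉≤1+⌊n/2⌋ : ∀ n → ⌈ n /2⌉ ≤ suc ⌊ n /2⌋
⌈n/2⌉≤1+⌊n/2⌋ zero          = z≤n
⌈n/2⌉≤1+⌊n/2⌋ (suc zero)    = s≤s z≤n
⌈n/2⌉≤1+⌊n/2⌋ (suc (suc n)) = s≤s (⌈n/2⌉≤1+⌊n/2⌋ n)

Lipschitz : (Fin n → Fin n → Bool) → (Fin n → ℕ) → Set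
Lipschitz A f = ∀ x y → A x y ≡ true → f x ≤ suc (f y)

module _ {A : Fin n → Fin n → Bool} where

  walk? : ∀ u w k → Dec (Walk A u w k)
  walk? u w zero    = map′ (λ { refl → here }) (λ { here → refl }) (u Fin.≟ w)
  walk? u w (suc k) = map′ (λ (x , e , p) → step e p) (λ { (step e p) → _ , e , p })
                           (any? λ x → (A u x Bool.≟ true) ×-dec walk? x w k)

  shortest : ∀ {u w} k → Walk A u w k → ∃ λ d → d ≤ k × Dist A u w d
  shortest {u} {w} = <-rec Shortens go
    where
    Shortens : ℕ → Set
    Shortens k = Walk A u w k → ∃ λ d → d ≤ k × Dist A u w d

    go : ∀ k → (∀ {j} → j < k → Shortens j) → Shortens k
    go k shorter p with anyUpTo? (walk? u w) k
    ... | yes (j , j<k , q) = let d , d≤j , dist = shorter j<k q in d , ≤-trans d≤j (<⇒≤ j<k) , dist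
    ... | no no-shorter     = k , ≤-refl , p , λ j j<k q → no-shorter (j , j<k , q)

  walk-length-zero : ∀ {u w} → Walk A u w 0 → u ≡ w
  walk-length-zero here = refl

  lipschitz-walk : ∀ {f u w} → Lipschitz A f → Walk A u w k → f u ≤ k + f w
  lipschitz-walk lip here               = ≤-refl
  lipschitz-walk lip (step {w = x} e p) = ≤-trans (lip _ x e) (s≤s (lipschitz-walk lip p))

  map-walk : {B : Fin n′ → Fin n′ → Bool} (g : Fin n → Fin n′) →
             (∀ {x y} → A x y ≡ true → B (g x) (g y) ≡ true) →
             ∀ {u w} → Walk A u w k → Walk B (g u) (g w) k
  map-walk g hom here       = here
  map-walk g hom (step e p) = step (hom e) (map-walk g hom p)

Covers : ℕ → List ℕ → Set
Covers r X = ∀ x → 1 ≤ x → x ≤ r → x ∈ X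

interval-split : ∀ {r D S} → (IsInterval r D × SubInterval r S) ⊎ (IsInterval r S × SubInterval r D) →
                 SubInterval r D × SubInterval r S × (Covers r D ⊎ Covers r S)
interval-split (inj₁ (D-interval , S⊆)) = (λ x → proj₁ (D-interval x)) , S⊆ , inj₁ (λ x → proj₂ (D-interval x))
interval-split (inj₂ (S-interval , D⊆)) = D⊆ , (λ x → proj₁ (S-interval x)) , inj₂ (λ x → proj₂ (S-interval x))

AtMostOnce : Colouring n → Colour → Set
AtMostOnce c κ = ∀ u w → c u ≡ κ → c w ≡ κ → u ≡ w

module _ {A : Fin n → Fin n → Bool} {c : Colouring n} {r : ℕ} where

  Sees : Fin n → Colour → Set
  Sees u κ = ∃ λ w → c w ≡ κ × ∃ λ d → Dist A u w d × 1 ≤ d × d ≤ r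

  sees-by-walk : ∀ {u w κ k} → c w ≡ κ → c u ≢ κ → Walk A u w k → k ≤ r → Sees u κ
  sees-by-walk {w = w} {k = k} cw cu≢κ p k≤r with shortest k p
  ... | zero  , _   , dist = ⊥-elim (cu≢κ (subst (λ x → c x ≡ _) (sym (walk-length-zero (proj₁ dist))) cw))
  ... | suc d , d≤k , dist = w , cw , suc d , dist , s≤s z≤n , ≤-trans d≤k k≤r

  blocked : ∀ {D S u} → Covers r D ⊎ Covers r S → Sees u red → Sees u blue →
            ¬ CanBlue D S A c u × ¬ CanRed D S A c u
  blocked {D} {S} {u} cover (x , cx , d , dx , 1≤d , d≤r) (y , cy , e , dy , 1≤e , e≤r) = no-blue , no-red
    where
    no-blue : ¬ CanBlue D S A c u
    no-blue = λ (_ , red-ok , blue-ok) →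
      [ (λ D-full → red-ok x d cx dx (D-full d 1≤d d≤r)) , (λ S-full → blue-ok y e cy dy (S-full e 1≤e e≤r)) ] cover
    no-red : ¬ CanRed D S A c u
    no-red = λ (_ , blue-ok , red-ok) →
      [ (λ D-full → blue-ok y e cy dy (D-full e 1≤e e≤r)) , (λ S-full → red-ok x d cx dx (S-full d 1≤d d≤r)) ] cover

  legal-of-apart : ∀ {D S} → SubInterval r D → SubInterval r S →
                   (∀ u w d → c u ≡ blue → c w ≡ red → Dist A u w d → suc r ≤ d) →
                   AtMostOnce c blue → AtMostOnce c red → Legal D S A c
  legal-of-apart {S = S} D⊆ S⊆ apart blue-once red-once =
    (λ u w d cu cw dist d∈D → <⇒≱ (apart u w d cu cw dist) (proj₂ (D⊆ d d∈D))) ,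
    monochrome blue-once , monochrome red-once
    where
    monochrome : ∀ {κ} → AtMostOnce c κ → ∀ u w s → c u ≡ κ → c w ≡ κ → Dist A u w s → ¬ (s ∈ S)
    monochrome once u w s cu cw (_ , minimal) s∈S with once u w cu cw
    ... | refl = minimal 0 (proj₁ (S⊆ s s∈S)) here

module _ {m : ℕ} where

  zeroOutside : (Fin m → ℕ) → Fin (m + n) → ℕ
  zeroOutside f x = [ f , (λ _ → 0) ] (splitAt m x)

  joinCol-↑ˡ : (cH : Colouring m) (cG : Colouring n) → ∀ a → joinCol cH cG (a ↑ˡ n) ≡ cH a
  joinCol-↑ˡ {n} cH cG a rewrite splitAt-↑ˡ m a n = refl

  module _ (H : Graph m) (v : Fin m) (G : Graph n) (E : Fin n → Bool) where

    joinAdj-↑ˡ : ∀ a b → joinAdj H v G E (a ↑ˡ n) (b ↑ˡ n) ≡ adj H a b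
    joinAdj-↑ˡ a b rewrite splitAt-↑ˡ m a n | splitAt-↑ˡ m b n = refl

    walk-↑ˡ : ∀ {a b} → Walk (adj H) a b k → Walk (joinAdj H v G E) (a ↑ˡ n) (b ↑ˡ n) k
    walk-↑ˡ = map-walk (_↑ˡ n) λ {a} {b} e → trans (joinAdj-↑ˡ a b) e

    attached-at-v : ∀ {a b} → ⌊ a Fin.≟ v ⌋ ∧ E b ≡ true → a ≡ v
    attached-at-v {a} e with a Fin.≟ v
    ... | yes a≡v = a≡v
    attached-at-v () | no _

    join-lipschitz : ∀ {f} → Lipschitz (adj H) f → f v ≤ 1 → Lipschitz (joinAdj H v G E) (zeroOutside f)
    join-lipschitz lip fv≤1 x y e with splitAt m x | splitAt m y
    ... | inj₁ a | inj₁ b = lip a b e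
    ... | inj₁ a | inj₂ b rewrite attached-at-v e = fv≤1
    ... | inj₂ _ | _      = z≤n

    lipschitz-distance-to-attached : ∀ {f} → Lipschitz (adj H) f → f v ≤ 1 →
                                     ∀ {u b d} → Dist (joinAdj H v G E) (u ↑ˡ n) (m ↑ʳ b) d → f u ≤ d
    lipschitz-distance-to-attached lip fv≤1 {u} {b} {d} (p , _)
      with lipschitz-walk (join-lipschitz lip fv≤1) p
    ... | bound rewrite splitAt-↑ˡ m u n | splitAt-↑ʳ m n b | +-identityʳ d = bound

module Induced {E : ℕ → ℕ → Set} (E? : ∀ x y → Dec (E x y)) (E-irrefl : ∀ {x} → ¬ E x x) (m : ℕ) where

  Adj : ℕ → ℕ → Set
  Adj x y = E x y ⊎ E y x

  adj? : ∀ x y → Dec (Adj x y)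
  adj? x y = E? x y ⊎-dec E? y x

  graph : Graph m
  graph = record
    { adj    = λ a b → does (adj? (toℕ a) (toℕ b))
    ; sym    = λ a b → ∨-comm (does (E? (toℕ a) (toℕ b))) (does (E? (toℕ b) (toℕ a)))
    ; irrefl = λ a → dec-false (adj? (toℕ a) (toℕ a)) [ E-irrefl , E-irrefl ]
    }

  adjacent-sound : ∀ {a b} → adj graph a b ≡ true → Adj (toℕ a) (toℕ b)
  adjacent-sound {a} {b} e = invert (subst (Reflects _) e (proof (adj? (toℕ a) (toℕ b))))

  lipschitz : (f : ℕ → ℕ) → (∀ {x y} → E x y → WithinOne (f x) (f y)) → Lipschitz (adj graph) (f ∘ toℕ)
  lipschitz f close a b e = [ proj₁ ∘ close , proj₂ ∘ close ] (adjacent-sound e)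

  infixr 5 _◅_ _◅◅_

  data Route : ℕ → ℕ → ℕ → Set where
    []  : ∀ {x} → Route x x 0
    _◅_ : ∀ {x y z k} → Adj x y → Route y z k → Route x z (suc k)

  _◅◅_ : ∀ {x y z k l} → Route x y k → Route y z l → Route x z (k + l)
  []      ◅◅ ρ′ = ρ′
  (e ◅ ρ) ◅◅ ρ′ = e ◅ (ρ ◅◅ ρ′)

  route-walk : (∀ {x y} → E x y → x < m × y < m) →
               ∀ {x y k} → Route x y k → (a : Fin m) → toℕ a ≡ x →
               ∃ λ b → toℕ b ≡ y × Walk (adj graph) a b k
  route-walk within []                 a refl = a , refl , here
  route-walk within (_◅_ {y = y} e ρ) a refl =
    let b , b≡ , p = route-walk within ρ next (toℕ-fromℕ< y<m) in b , b≡ , step first p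
    where
    y<m : y < m
    y<m = [ proj₂ ∘ within , proj₁ ∘ within ] e
    next : Fin m
    next = fromℕ< y<m
    first : adj graph a next ≡ true
    first = dec-true (adj? _ _) (subst (Adj (toℕ a)) (sym (toℕ-fromℕ< y<m)) e)

-- Labels (r = suc q): 0 … suc r is a path with the red end 0 and the blue end suc r; the hub
-- 2 + r is joined to the feet ⌈q/2⌉ and 2 + ⌊q/2⌋, which the reflection x ↦ suc r ∸ x swaps;
-- the tail hub, …, v = ⌊q/2⌋ + hub runs up from the hub to the distinguished vertex v.
module Gadget (q : ℕ) where

  r h t hub v size : ℕ
  r    = suc q
  h    = ⌊ q /2⌋
  t    = ⌈ q /2⌉
  hub  = suc (suc r)
  v    = h + hub
  size = suc v

  End : ℕ → Set
  End e = e ≡ 0 ⊎ e ≡ suc r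

  Foot : ℕ → Set
  Foot y = y ≡ t ⊎ y ≡ 2 + h

  foot? : ∀ y → Dec (Foot y)
  foot? y = (y ≟ t) ⊎-dec (y ≟ 2 + h)

  feet-span : t + (2 + h) ≡ suc r
  feet-span = trans (+-comm t (2 + h)) (cong (2 +_) (⌊n/2⌋+⌈n/2⌉≡n q))

  foot-on-path : ∀ {y} → Foot y → y ≤ suc r
  foot-on-path (inj₁ refl) = ≤-trans (⌈n/2⌉≤n q) (≤-trans (n≤1+n q) (n≤1+n r))
  foot-on-path (inj₂ refl) = s≤s (s≤s (⌊n/2⌋≤n q))

  foot-near-hub : ∀ {y} → Foot y → h ≤ y × y ≤ 2 + h
  foot-near-hub (inj₁ refl) = ⌊n/2⌋≤⌈n/2⌉ q , m≤n⇒m≤1+n (⌈n/2⌉≤1+⌊n/2⌋ q)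
  foot-near-hub (inj₂ refl) = m≤n⇒m≤1+n (n≤1+n h) , ≤-refl

  foot-mirror : ∀ {e y} → End e → Foot y → Foot ∣ y - e ∣
  foot-mirror {y = y} (inj₁ refl) f = subst Foot (sym (∣-∣-identityʳ y)) f
  foot-mirror (inj₂ refl) (inj₁ refl) =
    inj₂ (subst (λ z → ∣ t - z ∣ ≡ 2 + h) feet-span (∣m-m+n∣≡n t (2 + h)))
  foot-mirror (inj₂ refl) (inj₂ refl) =
    inj₁ (subst (λ z → ∣ 2 + h - z ∣ ≡ t) (trans (+-comm (2 + h) t) feet-span) (∣m-m+n∣≡n (2 + h) t))

  hub-off-path : ¬ hub ≤ suc r
  hub-off-path = 1+n≰n

  path-below-v : ∀ {x} → x ≤ suc r → x ≤ v
  path-below-v le = ≤-trans le (≤-trans (n≤1+n (suc r)) (m≤n+m hub h))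

  data Edge : ℕ → ℕ → Set where
    path : ∀ {x} → suc x ≤ suc r → Edge x (suc x)
    tail : ∀ {x} → hub ≤ x → suc x ≤ v → Edge x (suc x)
    leg  : ∀ {y} → Foot y → Edge hub y

  edge? : ∀ x y → Dec (Edge x y)
  edge? x y = map′ decode encode
    (((suc x ≟ y) ×-dec ((suc x ≤? suc r) ⊎-dec ((hub ≤? x) ×-dec (suc x ≤? v)))) ⊎-dec
     ((x ≟ hub) ×-dec foot? y))
    where
    Code : Set
    Code = (suc x ≡ y × (suc x ≤ suc r ⊎ hub ≤ x × suc x ≤ v)) ⊎ (x ≡ hub × Foot y)
    decode : Code → Edge x y
    decode (inj₁ (refl , inj₁ le))        = path le
    decode (inj₁ (refl , inj₂ (hx , le))) = tail hx le
    decode (inj₂ (refl , f))              = leg f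
    encode : Edge x y → Code
    encode (path le)    = inj₁ (refl , inj₁ le)
    encode (tail hx le) = inj₁ (refl , inj₂ (hx , le))
    encode (leg f)      = inj₂ (refl , f)

  edge-irrefl : ∀ {x} → ¬ Edge x x
  edge-irrefl (leg f) = hub-off-path (foot-on-path f)

  edge-within : ∀ {x y} → Edge x y → x < size × y < size
  edge-within (path {x} le)   = s≤s (path-below-v (≤-trans (n≤1+n x) le)) , s≤s (path-below-v le)
  edge-within (tail {x} _ le) = s≤s (≤-trans (n≤1+n x) le) , s≤s le
  edge-within (leg f)         = s≤s (m≤n+m hub h) , s≤s (path-below-v (foot-on-path f))

  open Induced edge? edge-irrefl size using (Route; []; _◅_; _◅◅_; lipschitz; route-walk)

  H : Graph size
  H = Induced.graph edge? edge-irrefl size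

  potential : ℕ → ℕ → ℕ
  potential e x with x ≤? suc r
  ... | yes _ = ∣ x - e ∣
  ... | no _  = size ∸ x

  potential-path : ∀ {e x} → x ≤ suc r → potential e x ≡ ∣ x - e ∣
  potential-path {x = x} le with x ≤? suc r
  ... | yes _ = refl
  ... | no x≰ = ⊥-elim (x≰ le)

  potential-tail : ∀ {e x} → hub ≤ x → potential e x ≡ size ∸ x
  potential-tail {x = x} hx with x ≤? suc r
  ... | yes x≤ = ⊥-elim (hub-off-path (≤-trans hx x≤))
  ... | no _   = refl

  edge-withinOne : ∀ {e x y} → End e → Edge x y → WithinOne (potential e x) (potential e y)
  edge-withinOne {e} _ (path {x} le)
    rewrite potential-path {e} (≤-trans (n≤1+n x) le) | potential-path {e} le = ∣-∣-suc-withinOne x e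
  edge-withinOne {e} _ (tail {x} hx le)
    rewrite potential-tail {e} hx | potential-tail {e} (≤-trans hx (n≤1+n x))
          | +-∸-assoc 1 (≤-trans (n≤1+n x) le) = ≤-refl , m≤n⇒m≤1+n (n≤1+n _)
  edge-withinOne {e} end (leg f)
    rewrite potential-tail {e} (≤-refl {hub}) | potential-path {e} (foot-on-path f) | m+n∸n≡m (suc h) hub
    = let lo , hi = foot-near-hub (foot-mirror end f) in s≤s lo , hi

  potential-lipschitz : ∀ {e} → End e → Lipschitz (adj H) (potential e ∘ toℕ)
  potential-lipschitz end = lipschitz _ (edge-withinOne end)

  potential-v : ∀ e → potential e (toℕ (fromℕ v)) ≤ 1
  potential-v e rewrite toℕ-fromℕ v | potential-tail {e} (m≤n+m hub h) = ≤-reflexive (m+n∸n≡m 1 v)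

  colour : ℕ → Colour
  colour x with x ≟ 0 | x ≟ suc r
  ... | yes _ | _     = red
  ... | no _  | yes _ = blue
  ... | no _  | no _  = none

  data Role (x : ℕ) : Colour → Set where
    red-end  : x ≡ 0 → Role x red
    blue-end : x ≡ suc r → Role x blue
    inner    : x ≢ 0 → x ≢ suc r → Role x none

  role : ∀ x → Role x (colour x)
  role x with x ≟ 0 | x ≟ suc r
  ... | yes x≡0 | _         = red-end x≡0
  ... | no x≢0  | yes x≡end = blue-end x≡end
  ... | no x≢0  | no x≢end  = inner x≢0 x≢end

  red-at : ∀ {x} → colour x ≡ red → x ≡ 0
  red-at {x} e with subst (Role x) e (role x)
  ... | red-end x≡0 = x≡0

  blue-at : ∀ {x} → colour x ≡ blue → x ≡ suc r
  blue-at {x} e with subst (Role x) e (role x)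
  ... | blue-end x≡end = x≡end

  uncoloured-at : ∀ {x} → colour x ≡ none → x ≢ 0 × x ≢ suc r
  uncoloured-at {x} e with subst (Role x) e (role x)
  ... | inner x≢0 x≢end = x≢0 , x≢end

  coloured-at : ∀ {x} → colour x ≢ none → End x
  coloured-at {x} coloured with colour x | role x
  ... | _ | red-end x≡0    = inj₁ x≡0
  ... | _ | blue-end x≡end = inj₂ x≡end
  ... | _ | inner _ _      = ⊥-elim (coloured refl)

  colour-blue-end : colour (suc r) ≡ blue
  colour-blue-end with suc r ≟ suc r
  ... | yes _ = refl
  ... | no ne = ⊥-elim (ne refl)

  colour-tail : ∀ {x} → hub ≤ x → colour x ≡ none
  colour-tail {x} hx with colour x | role x
  ... | _ | red-end refl  = case hx of λ ()
  ... | _ | blue-end refl = ⊥-elim (hub-off-path hx)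
  ... | _ | inner _ _     = refl

  cH : Colouring size
  cH = colour ∘ toℕ

  coloured-potential : ∀ {x} → colour x ≢ none → ∃ λ e → End e × potential e x ≡ suc r
  coloured-potential coloured with coloured-at coloured
  ... | inj₁ refl = suc r , inj₂ refl , potential-path z≤n
  ... | inj₂ refl = 0 , inj₁ refl , potential-path ≤-refl

  blue-red-apart : ∀ u w d → cH u ≡ blue → cH w ≡ red → Dist (adj H) u w d → suc r ≤ d
  blue-red-apart u w d cu cw (p , _) with lipschitz-walk (potential-lipschitz (inj₁ refl)) p
  ... | bound rewrite blue-at cu | red-at cw | potential-path {0} (≤-refl {suc r}) | +-identityʳ d = bound

  legal : ∀ {D S} → SubInterval r D → SubInterval r S → Legal D S (adj H) cH
  legal D⊆ S⊆ = legal-of-apart D⊆ S⊆ blue-red-apart (once blue-at) (once red-at)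
    where
    once : ∀ {κ e} → (∀ {x} → colour x ≡ κ → x ≡ e) → AtMostOnce cH κ
    once at u w cu cw = toℕ-injective (trans (at cu) (sym (at cw)))

  v-uncoloured : cH (fromℕ v) ≡ none
  v-uncoloured = trans (cong colour (toℕ-fromℕ v)) (colour-tail (m≤n+m hub h))

  Reach : ℕ → ℕ → Set
  Reach x y = ∃ λ k → k ≤ r × Route x y k

  descend : ∀ j → j ≤ suc r → Route j 0 j
  descend zero    _  = []
  descend (suc j) le = inj₂ (path le) ◅ descend j (≤-trans (n≤1+n j) le)

  ascend : ∀ k {j} → k + j ≡ suc r → Route j (suc r) k
  ascend zero    refl = []
  ascend (suc k) {j} eq =
    inj₁ (path (subst (suc j ≤_) eq (s≤s (m≤n+m j k)))) ◅ ascend k (trans (+-suc k j) eq)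

  descend-tail : ∀ i → i ≤ h → Route (i + hub) hub i
  descend-tail zero    _  = []
  descend-tail (suc i) le = inj₂ (tail (m≤n+m hub i) (+-monoˡ-≤ hub le)) ◅ descend-tail i (≤-trans (n≤1+n i) le)

  path-reach : ∀ j → suc j ≤ r → Reach (suc j) 0 × Reach (suc j) (suc r)
  path-reach j sj≤r = (suc j , sj≤r , descend (suc j) (m≤n⇒m≤1+n sj≤r)) ,
                      (r ∸ j , m∸n≤m r j , ascend (r ∸ j) (m∸n+n≡m (m≤n⇒m≤1+n sj≤r)))

  tail-reach : ∀ i → i ≤ h → Reach (i + hub) 0 × Reach (i + hub) (suc r)
  tail-reach i i≤h =
    (i + suc t , short , descend-tail i i≤h ◅◅ inj₁ (leg (inj₁ refl)) ◅ descend t (foot-on-path (inj₁ refl))) ,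
    (i + suc t , short , descend-tail i i≤h ◅◅ inj₁ (leg (inj₂ refl)) ◅ ascend t feet-span)
    where
    short : i + suc t ≤ r
    short = ≤-trans (+-monoˡ-≤ (suc t) i≤h) (≤-reflexive (trans (+-suc h t) (cong suc (⌊n/2⌋+⌈n/2⌉≡n q))))

  reach-ends : ∀ {x} → x ≢ 0 → x ≢ suc r → x < size → Reach x 0 × Reach x (suc r)
  reach-ends {zero}  x≢0 _ _ = ⊥-elim (x≢0 refl)
  reach-ends {suc j} _ x≢end x<size with suc j ≤? suc r
  ... | yes x≤end = path-reach j (s≤s⁻¹ (≤∧≢⇒< x≤end x≢end))
  ... | no x≰end  = subst (λ z → Reach z 0 × Reach z (suc r)) (m∸n+n≡m hub≤x) (tail-reach (suc j ∸ hub) i≤h)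
    where
    hub≤x : hub ≤ suc j
    hub≤x = ≰⇒> x≰end
    i≤h : suc j ∸ hub ≤ h
    i≤h = subst (suc j ∸ hub ≤_) (m+n∸n≡m h hub) (∸-monoˡ-≤ hub (s≤s⁻¹ x<size))

  module _ (G : Graph n) (cG : Colouring n) (E : Fin n → Bool) where

    sees-end : ∀ {u y κ} → cH u ≡ none → colour y ≡ κ → κ ≢ none → Reach (toℕ u) y →
               Sees {A = joinAdj H (fromℕ v) G E} {c = joinCol cH cG} {r = r} (u ↑ˡ n) κ
    sees-end {u} {κ = κ} cu cy κ-coloured (k , k≤r , ρ) with route-walk edge-within ρ u refl
    ... | b , refl , p = sees-by-walk (trans (joinCol-↑ˡ cH cG b) cy) u-not-κ (walk-↑ˡ H (fromℕ v) G E p) k≤r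
      where
      u-not-κ : joinCol cH cG (u ↑ˡ n) ≢ κ
      u-not-κ = λ cu≡κ → κ-coloured (trans (sym cu≡κ) (trans (joinCol-↑ˡ cH cG u) cu))

    uncoloured-blocked : ∀ {D S} → Covers r D ⊎ Covers r S → ∀ u → cH u ≡ none →
                         ¬ CanBlue D S (joinAdj H (fromℕ v) G E) (joinCol cH cG) (u ↑ˡ n) ×
                         ¬ CanRed D S (joinAdj H (fromℕ v) G E) (joinCol cH cG) (u ↑ˡ n)
    uncoloured-blocked cover u cu =
      let u≢0 , u≢end      = uncoloured-at cu
          to-red , to-blue = reach-ends u≢0 u≢end (toℕ<n u)
      in blocked cover (sees-end cu refl (λ ()) to-red) (sees-end cu colour-blue-end (λ ()) to-blue)

    coloured-far : ∀ u → cH u ≢ none → ∀ b d → Dist (joinAdj H (fromℕ v) G E) (u ↑ˡ n) (size ↑ʳ b) d → suc r ≤ d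
    coloured-far u coloured b d dist =
      let e , end , potential≡ = coloured-potential coloured
      in subst (_≤ d) potential≡
           (lipschitz-distance-to-attached H (fromℕ v) G E (potential-lipschitz end) (potential-v e) dist)

lemma1 : (r : ℕ) → 1 ≤ r → (D S : List ℕ) →
    ((IsInterval r D × SubInterval r S) ⊎ (IsInterval r S × SubInterval r D)) →
    Σ ℕ λ m → Σ (Graph m) λ H → Σ (Fin m) λ v → Σ (Colouring m) λ cH →
      Legal D S (adj H) cH × cH v ≡ none ×
      ((n : ℕ) (G : Graph n) (cG : Colouring n) → Legal D S (adj G) cG →
       (E : Fin n → Bool) →
         ((u : Fin m) → cH u ≡ none →
            ¬ CanBlue D S (joinAdj H v G E) (joinCol cH cG) (u ↑ˡ n) ×
            ¬ CanRed D S (joinAdj H v G E) (joinCol cH cG) (u ↑ˡ n)) ×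
         ((u : Fin m) → cH u ≢ none → (b : Fin n) → (d : ℕ) →
            Dist (joinAdj H v G E) (u ↑ˡ n) (m ↑ʳ b) d → suc r ≤ d))
lemma1 zero    ()
lemma1 (suc q) _ D S hypothesis with interval-split hypothesis
... | D⊆ , S⊆ , cover =
  size , H , fromℕ v , cH , legal D⊆ S⊆ , v-uncoloured ,
  -- cG need not be legal: the argument never looks at the colours of G
  λ n G cG _ E → uncoloured-blocked G cG E cover , coloured-far G cG E
  where open Gadget q
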